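{- For every small free wedge whose boundaries lie in opposite quadrants, there exists a finite deterministic automaton that explores it using two pebbles.
   Context: The oriented grid $\mathbb{Z}\times\mathbb{Z}$ is embedded in the plane (nodes at integer points, edges between nodes at distance 1); nodes are anonymous and every node has ports $N,E,S,W$ pointing North, East, South, West. Given two half-lines $H_1,H_2$ in the plane with a common origin $O$ (arbitrary real directions), let $W(H_1,H_2)$ be the closed region swept clockwise from $H_1$ to $H_2$ (half-lines included); the wedge is the subgraph of the grid induced by the grid nodes in $W(H_1,H_2)$. It is small if the clockwise angle from $H_1$ to $H_2$ is less than $\pi$. The boundaries lie in opposite quadrants if the direction vectors of $H_1$ and $H_2$ lie in two opposite open quadrants of the plane, including the limit case where one of the boundaries is horizontal or vertical. A wedge is free if all ports at all nodes of the grid are free (the agent moves in the whole grid unrestricted but must visit all nodes of the wedge); the origin $O$ is the starting node of the agent. The agent is a finite deterministic (Mealy) automaton carrying $p$ pebbles: at each step it sees whether a pebble lies on the current node and how many pebbles it carries; depending on its state and this input it moves through a port, possibly dropping a pebble on the empty current node (if it carries one) or picking up the pebble lying there, and changes state. It starts in its initial state with all $p$ pebbles, with no pebbles on the grid. The automaton explores the wedge if every node of the wedge is eventually visited. -}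

module Defs where

open import Data.Nat as ℕ using (ℕ; zero; suc)
open import Data.Integer as ℤ using (ℤ; +_; -[1+_]; +[1+_])
open import Data.Integer.Properties as ℤP using ()
open import Data.Rational as ℚ using (ℚ; _/_)
open import Data.Fin using (Fin)
open import Data.Bool using (Bool; true; false; if_then_else_)
open import Data.Product using (_×_; _,_; ∃; Σ)
open import Data.Product.Properties using (≡-dec)
open import Data.Sum using (_⊎_)
open import Relation.Nullary using (¬_; yes; no)
open import Relation.Binary.PropositionalEquality using (_≡_; _≢_)

-- Real numbers (classical), encoded as Dedekind cuts of ℚ given by a
-- three-way comparison of every rational q with the real x:
--   cmp q ≡ less    means  q < x
--   cmp q ≡ same    means  q = x
--   cmp q ≡ greater means  q > x
-- The axioms below say exactly that {q | q < x} and {q | q > x} form a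
-- Dedekind cut whose gap contains at most one rational, which is then
-- the one marked 'same'.  Every real number gives a unique such record.

data Cmp : Set where
  less same greater : Cmp

record ℝ : Set where
  field
    cmp         : ℚ → Cmp
    less-down   : ∀ {q q′} → q′ ℚ.< q → cmp q ≡ less → cmp q′ ≡ less
    greater-up  : ∀ {q q′} → q ℚ.< q′ → cmp q ≡ greater → cmp q′ ≡ greater
    same-above  : ∀ {q q′} → cmp q ≡ same → q ℚ.< q′ → cmp q′ ≡ greater
    same-below  : ∀ {q q′} → cmp q ≡ same → q′ ℚ.< q → cmp q′ ≡ less
    less-open   : ∀ {q} → cmp q ≡ less → ∃ λ q′ → q ℚ.< q′ × cmp q′ ≡ less
    greater-open : ∀ {q} → cmp q ≡ greater → ∃ λ q′ → q′ ℚ.< q × cmp q′ ≡ greater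
    less-inhabited    : ∃ λ q → cmp q ≡ less
    greater-inhabited : ∃ λ q → cmp q ≡ greater

open ℝ public

_ℚ≤ℝ_ : ℚ → ℝ → Set
q ℚ≤ℝ x = cmp x q ≢ greater

_ℝ≤ℚ_ : ℝ → ℚ → Set
x ℝ≤ℚ q = cmp x q ≢ less

_ℚ<ℝ_ : ℚ → ℝ → Set
q ℚ<ℝ x = cmp x q ≡ less

_ℝ<ℚ_ : ℝ → ℚ → Set
x ℝ<ℚ q = cmp x q ≡ greater

_ℝ<ℝ_ : ℝ → ℝ → Set
x ℝ<ℝ y = ∃ λ q → x ℝ<ℚ q × q ℚ<ℝ y

-- For integers A, s and a real t:  A ≤ s·t  and  s·t ≤ A.
LeMul : ℤ → ℤ → ℝ → Set
LeMul A (+ zero)   t = A ℤ.≤ + 0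
LeMul A +[1+ n ]   t = (A / suc n) ℚ≤ℝ t
LeMul A -[1+ n ]   t = t ℝ≤ℚ ((ℤ.- A) / suc n)

MulLe : ℤ → ℤ → ℝ → Set
MulLe A (+ zero)   t = + 0 ℤ.≤ A
MulLe A +[1+ n ]   t = t ℝ≤ℚ (A / suc n)
MulLe A -[1+ n ]   t = ((ℤ.- A) / suc n) ℚ≤ℝ t

-- A nonzero direction vector lying in the closed quadrant with signs
-- (σx, σy) ∈ {±1}² is, up to positive scaling, the point
--     d = (σx·(1 - t), σy·t)      with 0 ≤ t ≤ 1
-- of the L¹ unit circle.  t = 0 / t = 1 : d is horizontal / vertical;
-- 0 < t < 1 : d lies in the open quadrant.

data Sgn : Set where
  plus minus : Sgn

sgn : Sgn → ℤ
sgn plus = + 1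
sgn minus = ℤ.- (+ 1)

flip : Sgn → Sgn
flip plus = minus
flip minus = plus

record Direction : Set where
  constructor dir
  field
    σx σy : Sgn
    t     : ℝ
    t≥0   : (+ 0 / 1) ℚ≤ℝ t
    t≤1   : t ℝ≤ℚ (+ 1 / 1)

open Direction public

InOpenQuadrant : Direction → Set
InOpenQuadrant d = ((+ 0 / 1) ℚ<ℝ t d) × (t d ℝ<ℚ (+ 1 / 1))

-- For a grid vector p = (x , y):
--   cross(d , p) = σx(1-t)·y - σy·t·x = A - t·s
-- with A = σx·y and s = σx·y + σy·x.
crossA crossS : Direction → ℤ × ℤ → ℤ
crossA d (x , y) = sgn (σx d) ℤ.* y
crossS d (x , y) = sgn (σx d) ℤ.* y ℤ.+ sgn (σy d) ℤ.* x

CrossNonPos : Direction → ℤ × ℤ → Set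
CrossNonPos d p = LeMul (crossA d p) (crossS d p) (t d)

CrossNonNeg : Direction → ℤ × ℤ → Set
CrossNonNeg d p = MulLe (crossA d p) (crossS d p) (t d)

-- H₁ has direction d₁ in the closed quadrant (σx, σy), H₂ has direction
-- d₂ in the closed opposite quadrant (-σx, -σy), and at least one of
-- them lies in its open quadrant (so at most one boundary is horizontal
-- or vertical).

record OppWedge : Set where
  field
    O      : ℤ × ℤ
    d₁ d₂  : Direction
    opp-x  : σx d₂ ≡ flip (σx d₁)
    opp-y  : σy d₂ ≡ flip (σy d₁)
    open-one : InOpenQuadrant d₁ ⊎ InOpenQuadrant d₂

open OppWedge public

-- With d₂ opposite to d₁:  cross(d₁ , d₂) = σxσy·(t₁ - t₂).
-- The clockwise angle from H₁ to H₂ is < π  iff  cross(d₁ , d₂) < 0,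
-- i.e. iff  σxσy·(t₁ - t₂) < 0.
Small : OppWedge → Set
Small w with σx (d₁ w) | σy (d₁ w)
... | plus | plus = t (d₁ w) ℝ<ℝ t (d₂ w)
... | minus | minus = t (d₁ w) ℝ<ℝ t (d₂ w)
... | plus | minus = t (d₂ w) ℝ<ℝ t (d₁ w)
... | minus | plus = t (d₂ w) ℝ<ℝ t (d₁ w)

_-ᵥ_ : ℤ × ℤ → ℤ × ℤ → ℤ × ℤ
(a , b) -ᵥ (c , e) = (a ℤ.- c , b ℤ.- e)

-- Grid node v lies in the closed region swept clockwise from H₁ to H₂.
-- For a small wedge this region is the intersection of the closed
-- half-plane clockwise of H₁ and the closed half-plane counter-clockwise
-- of H₂.
InWedge : OppWedge → ℤ × ℤ → Set
InWedge w v = CrossNonPos (d₁ w) (v -ᵥ O w) × CrossNonNeg (d₂ w) (v -ᵥ O w)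

data Port : Set where
  N E S W : Port

data Action : Set where
  none drop pick : Action

move : Port → ℤ × ℤ → ℤ × ℤ
move N (x , y) = (x , y ℤ.+ + 1)
move S (x , y) = (x , y ℤ.- + 1)
move E (x , y) = (x ℤ.+ + 1 , y)
move W (x , y) = (x ℤ.- + 1 , y)

-- states are Fin nStates; input = (pebble on current node?, number of
-- pebbles carried ∈ {0..p}); output = (port, pebble action, new state).
record Automaton (p : ℕ) : Set where
  field
    nStates : ℕ
    init    : Fin nStates
    δ       : Fin nStates → Bool → Fin (suc p) → Port × Action × Fin nStates

open Automaton public

-- number of carried pebbles (always ≤ p in a run) as an element of Fin (suc p)
clamp : (p : ℕ) → ℕ → Fin (suc p)
clamp p zero = Fin.zero
clamp zero (suc k) = Fin.zero
clamp (suc p) (suc k) = Fin.suc (clamp p k)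

record Config {p : ℕ} (A : Automaton p) : Set where
  constructor cfg
  field
    pos     : ℤ × ℤ
    state   : Fin (nStates A)
    pebbles : ℤ × ℤ → Bool
    carried : ℕ

open Config public

_≟ᵥ_ : (u v : ℤ × ℤ) → Relation.Nullary.Dec (u ≡ v)
_≟ᵥ_ = ≡-dec ℤ._≟_ ℤ._≟_

set : (ℤ × ℤ → Bool) → ℤ × ℤ → Bool → ℤ × ℤ → Bool
set f u b v with v ≟ᵥ u
... | yes _ = b
... | no  _ = f v

-- Pebble action at the current node (an impossible drop/pick is a no-op),
-- then move through the chosen port.
step : ∀ {p} (A : Automaton p) → Config A → Config A
step {p} A (cfg u q peb c) with δ A q (peb u) (clamp p c)
... | (port , none , q′) = cfg (move port u) q′ peb c
... | (port , drop , q′) with peb u | c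
...   | false | suc c′ = cfg (move port u) q′ (set peb u true) c′
...   | _     | _      = cfg (move port u) q′ peb c
step {p} A (cfg u q peb c) | (port , pick , q′) with peb u
...   | true  = cfg (move port u) q′ (set peb u false) (suc c)
...   | false = cfg (move port u) q′ peb c

iter : ∀ {a} {X : Set a} → ℕ → (X → X) → X → X
iter zero    f x = x
iter (suc k) f x = f (iter k f x)

run : ∀ {p} (A : Automaton p) → ℤ × ℤ → ℕ → Config A
run {p} A O k = iter k (step A) (cfg O (init A) (λ _ → false) p)

-- A explores the free wedge w: every node of the wedge is eventually
-- visited (the agent moves freely in the whole grid).
Explores : ∀ {p} → Automaton p → OppWedge → Set
Explores A w = ∀ v → InWedge w v → ∃ λ k → pos (run A (O w) k) ≡ v

-- The wedge is explored through a lattice that covers it.  In the coordinates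
-- (σy·x, σx·y) both boundaries become lines Y = t·(X + Y); as the wedge is small
-- their slopes differ, and two rationals strictly between them bound a rational
-- cone containing the wedge.  That cone is spanned by integer vectors R₁, R₂, and
-- each of its integer points lies within a fixed distance of a lattice point
-- O + i·R₁ + j·R₂ with i, j ≥ 0 (round down Cramer's coefficients).  The
-- automaton visits the lattice points diagonal by diagonal, surveying a square
-- of that radius around each; its two pebbles mark the ends of the current
-- diagonal, telling it where to turn, and each is pushed one step outward at the
-- turn that reaches it.

{-# OPTIONS --safe #-}
module Submission where

open import Defs
open import Data.Bool using (Bool; true; false; if_then_else_; _∨_)
open import Data.Empty using (⊥-elim)
open import Data.Fin using (Fin; toℕ)
open import Data.Integer as ℤ using (ℤ; +_; -[1+_]; +[1+_]; ∣_∣)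
import Data.Integer.Properties as ℤP
import Data.Bool.Properties as BoolP
open import Data.Integer.Tactic.RingSolver using (solve-∀)
open import Data.Integer.GCD using (gcd)
open import Data.Rational as ℚ using (ℚ; ↥_; ↧_)
import Data.Rational.Properties as ℚP
open import Data.List using (List; []; _∷_; _++_; length; replicate; map; concat; take)
import Data.List.Properties as ListP
open import Data.Nat as ℕ using (ℕ; zero; suc)
import Data.Nat.Properties as ℕP
open import Data.Nat.DivMod using (_/_; _%_; m≡m%n+[m/n]*n; m%n<n)
open import Data.Product using (_×_; _,_; ∃; Σ; proj₁; proj₂; uncurry)
open import Data.Sum using (_⊎_; inj₁; inj₂)
open import Data.Unit using (⊤; tt)
open import Relation.Binary.PropositionalEquality
open import Relation.Nullary using (yes; no; does)

Point : Set
Point = ℤ × ℤ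

infixl 6 _+ᵥ_
infixr 7 _·ᵥ_

_+ᵥ_ : Point → Point → Point
(a , b) +ᵥ (c , d) = (a ℤ.+ c , b ℤ.+ d)

_·ᵥ_ : ℤ → Point → Point
s ·ᵥ (a , b) = (s ℤ.* a , s ℤ.* b)

move-S-N : ∀ u → move S (move N u) ≡ u
move-S-N (x , y) = cong (x ,_) (trans (ℤP.+-assoc y (+ 1) -[1+ 0 ]) (ℤP.+-identityʳ y))

walk : Point → List Port → Point
walk u []       = u
walk u (p ∷ ps) = walk (move p u) ps

walk-++ : ∀ u ps qs → walk u (ps ++ qs) ≡ walk (walk u ps) qs
walk-++ u []       qs = refl
walk-++ u (p ∷ ps) qs = walk-++ (move p u) ps qs

minus-suc : ∀ x n → x ℤ.- + 1 ℤ.- + n ≡ x ℤ.- + suc n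
minus-suc x n = trans (ℤP.+-assoc x (ℤ.- + 1) (ℤ.- + n)) (cong (λ z → x ℤ.+ z) (sym (ℤP.neg-distrib-+ (+ 1) (+ n))))

walk-E : ∀ n x y → walk (x , y) (replicate n E) ≡ (x ℤ.+ + n , y)
walk-E zero    x y = cong (_, y) (sym (ℤP.+-identityʳ x))
walk-E (suc n) x y = trans (walk-E n (x ℤ.+ + 1) y) (cong (_, y) (ℤP.+-assoc x (+ 1) (+ n)))

walk-N : ∀ n x y → walk (x , y) (replicate n N) ≡ (x , y ℤ.+ + n)
walk-N zero    x y = cong (x ,_) (sym (ℤP.+-identityʳ y))
walk-N (suc n) x y = trans (walk-N n x (y ℤ.+ + 1)) (cong (x ,_) (ℤP.+-assoc y (+ 1) (+ n)))

walk-W : ∀ n x y → walk (x , y) (replicate n W) ≡ (x ℤ.- + n , y)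
walk-W zero    x y = cong (_, y) (sym (ℤP.+-identityʳ x))
walk-W (suc n) x y = trans (walk-W n (x ℤ.- + 1) y) (cong (_, y) (minus-suc x n))

walk-S : ∀ n x y → walk (x , y) (replicate n S) ≡ (x , y ℤ.- + n)
walk-S zero    x y = cong (x ,_) (sym (ℤP.+-identityʳ y))
walk-S (suc n) x y = trans (walk-S n x (y ℤ.- + 1)) (cong (x ,_) (minus-suc y n))

horizontal : ℤ → List Port
horizontal (+ n)    = replicate n E
horizontal -[1+ n ] = replicate (suc n) W

vertical : ℤ → List Port
vertical (+ n)    = replicate n N
vertical -[1+ n ] = replicate (suc n) S

straight : Point → List Port
straight (dx , dy) = horizontal dx ++ vertical dy

walk-horizontal : ∀ dx x y → walk (x , y) (horizontal dx) ≡ (x ℤ.+ dx , y)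
walk-horizontal (+ n)    = walk-E n
walk-horizontal -[1+ n ] = walk-W (suc n)

walk-vertical : ∀ dy x y → walk (x , y) (vertical dy) ≡ (x , y ℤ.+ dy)
walk-vertical (+ n)    = walk-N n
walk-vertical -[1+ n ] = walk-S (suc n)

walk-straight : ∀ u d → walk u (straight d) ≡ u +ᵥ d
walk-straight (x , y) (dx , dy) = begin
  walk (x , y) (horizontal dx ++ vertical dy)     ≡⟨ walk-++ (x , y) (horizontal dx) (vertical dy) ⟩
  walk (walk (x , y) (horizontal dx)) (vertical dy) ≡⟨ cong (λ u → walk u (vertical dy)) (walk-horizontal dx x y) ⟩
  walk (x ℤ.+ dx , y) (vertical dy)               ≡⟨ walk-vertical dy (x ℤ.+ dx) y ⟩
  (x ℤ.+ dx , y ℤ.+ dy)                           ∎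
  where open ≡-Reasoning

data Passes : Point → List Port → Point → Set where
  here  : ∀ {u ps} → Passes u ps u
  there : ∀ {u p ps v} → Passes (move p u) ps v → Passes u (p ∷ ps) v

passes-++ˡ : ∀ {u ps v} qs → Passes u ps v → Passes u (ps ++ qs) v
passes-++ˡ qs here      = here
passes-++ˡ qs (there π) = there (passes-++ˡ qs π)

passes-++ʳ : ∀ {u} ps {qs v} → Passes (walk u ps) qs v → Passes u (ps ++ qs) v
passes-++ʳ []       π = π
passes-++ʳ (p ∷ ps) π = there (passes-++ʳ ps π)

passes-replicate : ∀ {i n} p u → i ℕ.≤ n → Passes u (replicate n p) (walk u (replicate i p))
passes-replicate p u ℕ.z≤n       = here
passes-replicate p u (ℕ.s≤s i≤n) = there (passes-replicate p (move p u) i≤n)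

-- Surveying a square

+-minus : ∀ x z → x ℤ.+ z ℤ.- z ≡ x
+-minus x z = trans (ℤP.+-assoc x z (ℤ.- z)) (trans (cong (λ w → x ℤ.+ w) (ℤP.+-inverseʳ z)) (ℤP.+-identityʳ x))

row : ℕ → List Port
row w = replicate w E ++ replicate w W ++ N ∷ []

rows : ℕ → ℕ → List Port
rows w zero    = []
rows w (suc h) = row w ++ rows w h

toCorner : ℕ → List Port
toCorner R = replicate R W ++ replicate R S

fromTop : ℕ → List Port
fromTop R = replicate (suc R) S ++ replicate R E

survey : ℕ → List Port
survey R = toCorner R ++ rows (R ℕ.+ R) (suc (R ℕ.+ R)) ++ fromTop R

walk-row : ∀ w x y → walk (x , y) (row w) ≡ (x , y ℤ.+ + 1)
walk-row w x y = begin
  walk (x , y) (replicate w E ++ replicate w W ++ N ∷ [])   ≡⟨ walk-++ (x , y) (replicate w E) _ ⟩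
  walk (walk (x , y) (replicate w E)) (replicate w W ++ N ∷ []) ≡⟨ cong (λ u → walk u (replicate w W ++ N ∷ [])) (walk-E w x y) ⟩
  walk (x ℤ.+ + w , y) (replicate w W ++ N ∷ [])            ≡⟨ walk-++ (x ℤ.+ + w , y) (replicate w W) (N ∷ []) ⟩
  move N (walk (x ℤ.+ + w , y) (replicate w W))             ≡⟨ cong (move N) (walk-W w (x ℤ.+ + w) y) ⟩
  move N (x ℤ.+ + w ℤ.- + w , y)                            ≡⟨ cong (λ x′ → move N (x′ , y)) (+-minus x (+ w)) ⟩
  (x , y ℤ.+ + 1)                                           ∎
  where open ≡-Reasoning

walk-rows : ∀ w h x y → walk (x , y) (rows w h) ≡ (x , y ℤ.+ + h)
walk-rows w zero    x y = cong (x ,_) (sym (ℤP.+-identityʳ y))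
walk-rows w (suc h) x y = begin
  walk (x , y) (row w ++ rows w h)        ≡⟨ walk-++ (x , y) (row w) (rows w h) ⟩
  walk (walk (x , y) (row w)) (rows w h)  ≡⟨ cong (λ u → walk u (rows w h)) (walk-row w x y) ⟩
  walk (x , y ℤ.+ + 1) (rows w h)         ≡⟨ walk-rows w h x (y ℤ.+ + 1) ⟩
  (x , y ℤ.+ + 1 ℤ.+ + h)                 ≡⟨ cong (x ,_) (ℤP.+-assoc y (+ 1) (+ h)) ⟩
  (x , y ℤ.+ + suc h)                     ∎
  where open ≡-Reasoning

walk-toCorner : ∀ R x y → walk (x , y) (toCorner R) ≡ (x ℤ.- + R , y ℤ.- + R)
walk-toCorner R x y =
  trans (walk-++ (x , y) (replicate R W) (replicate R S))
        (trans (cong (λ u → walk u (replicate R S)) (walk-W R x y)) (walk-S R (x ℤ.- + R) y))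

walk-survey : ∀ R u → walk u (survey R) ≡ u
walk-survey R (x , y) = begin
  walk (x , y) (toCorner R ++ rows R₂ (suc R₂) ++ fromTop R)             ≡⟨ walk-++ (x , y) (toCorner R) _ ⟩
  walk (walk (x , y) (toCorner R)) (rows R₂ (suc R₂) ++ fromTop R)       ≡⟨ cong (λ u → walk u (rows R₂ (suc R₂) ++ fromTop R)) (walk-toCorner R x y) ⟩
  walk (x ℤ.- + R , y ℤ.- + R) (rows R₂ (suc R₂) ++ fromTop R)           ≡⟨ walk-++ _ (rows R₂ (suc R₂)) (fromTop R) ⟩
  walk (walk (x ℤ.- + R , y ℤ.- + R) (rows R₂ (suc R₂))) (fromTop R)     ≡⟨ cong (λ u → walk u (fromTop R)) (walk-rows R₂ (suc R₂) (x ℤ.- + R) (y ℤ.- + R)) ⟩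
  walk (x ℤ.- + R , y ℤ.- + R ℤ.+ + suc R₂) (fromTop R)                  ≡⟨ walk-++ (x ℤ.- + R , y ℤ.- + R ℤ.+ + suc R₂) (replicate (suc R) S) (replicate R E) ⟩
  walk (walk (x ℤ.- + R , y ℤ.- + R ℤ.+ + suc R₂) (replicate (suc R) S)) (replicate R E)
                                                                           ≡⟨ cong (λ u → walk u (replicate R E)) (walk-S (suc R) (x ℤ.- + R) (y ℤ.- + R ℤ.+ + suc R₂)) ⟩
  walk (x ℤ.- + R , y ℤ.- + R ℤ.+ + suc R₂ ℤ.- + suc R) (replicate R E)  ≡⟨ walk-E R _ _ ⟩
  (x ℤ.- + R ℤ.+ + R , y ℤ.- + R ℤ.+ + suc R₂ ℤ.- + suc R)               ≡⟨ cong₂ _,_ (back-x x (+ R)) (back-y y (+ R)) ⟩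
  (x , y)                                                                  ∎
  where
  open ≡-Reasoning
  R₂ = R ℕ.+ R
  back-x : ∀ x r → x ℤ.- r ℤ.+ r ≡ x
  back-x = solve-∀
  back-y : ∀ y r → y ℤ.- r ℤ.+ (+ 1 ℤ.+ (r ℤ.+ r)) ℤ.- (+ 1 ℤ.+ r) ≡ y
  back-y = solve-∀

passes-row : ∀ {w i} x y → i ℕ.≤ w → Passes (x , y) (row w) (x ℤ.+ + i , y)
passes-row {w} {i} x y i≤w =
  passes-++ˡ _ (subst (Passes (x , y) (replicate w E)) (walk-E i x y) (passes-replicate E (x , y) i≤w))

passes-rows : ∀ {w i j} h x y → i ℕ.≤ w → j ℕ.< h → Passes (x , y) (rows w h) (x ℤ.+ + i , y ℤ.+ + j)
passes-rows {w} {i} {zero} (suc h) x y i≤w _ =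
  passes-++ˡ (rows w h) (subst (λ y′ → Passes (x , y) (row w) (x ℤ.+ + i , y′)) (sym (ℤP.+-identityʳ y)) (passes-row x y i≤w))
passes-rows {w} {i} {suc j} (suc h) x y i≤w (ℕ.s≤s j<h) =
  passes-++ʳ (row w) (subst₂ (λ u y′ → Passes u (rows w h) (x ℤ.+ + i , y′)) (sym (walk-row w x y)) (ℤP.+-assoc y (+ 1) (+ j))
                              (passes-rows h x (y ℤ.+ + 1) i≤w j<h))

centred : ∀ {z R} → ∣ z ∣ ℕ.≤ R → ∃ λ i → i ℕ.≤ R ℕ.+ R × + i ℤ.- + R ≡ z
centred {+ n} {R} n≤R = n ℕ.+ R , ℕP.+-monoˡ-≤ R n≤R , +-minus (+ n) (+ R)
centred { -[1+ n ]} n<R with ℕP.m≤n⇒∃[o]m+o≡n n<R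
... | m , refl = m , ℕP.≤-trans (ℕP.m≤n+m m (suc n)) (ℕP.m≤m+n (suc n ℕ.+ m) (suc n ℕ.+ m)) , ring (+ m) (+ suc n)
  where
  ring : ∀ m s → m ℤ.- (s ℤ.+ m) ≡ ℤ.- s
  ring = solve-∀

Within : ℕ → Point → Set
Within R (dx , dy) = ∣ dx ∣ ℕ.≤ R × ∣ dy ∣ ℕ.≤ R

passes-survey : ∀ {R} u d → Within R d → Passes u (survey R) (u +ᵥ d)
passes-survey {R} (x , y) (dx , dy) (bx , by) with centred {dx} bx | centred {dy} by
... | i , i≤ , refl | j , j≤ , refl =
  passes-++ʳ (toCorner R) (subst (λ u → Passes u (rows R₂ (suc R₂) ++ fromTop R) target) (sym (walk-toCorner R x y))
    (passes-++ˡ (fromTop R) (subst (Passes (x ℤ.- + R , y ℤ.- + R) (rows R₂ (suc R₂)))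
                                   (cong₂ _,_ (shift x (+ R) (+ i)) (shift y (+ R) (+ j)))
      (passes-rows (suc R₂) (x ℤ.- + R) (y ℤ.- + R) i≤ (ℕ.s≤s j≤)))))
  where
  R₂ = R ℕ.+ R
  target = (x , y) +ᵥ (+ i ℤ.- + R , + j ℤ.- + R)
  shift : ∀ x r i → x ℤ.- r ℤ.+ i ≡ x ℤ.+ (i ℤ.- r)
  shift = solve-∀

-- Programs and the automata running them

lookupOr : {A : Set} → A → List A → ℕ → A
lookupOr d []       n       = d
lookupOr d (x ∷ xs) zero    = x
lookupOr d (x ∷ xs) (suc n) = lookupOr d xs n

lookupOr-clamp : {A : Set} (d : A) (xs : List A) (o : ℕ) → lookupOr d xs (toℕ (clamp (length xs) o)) ≡ lookupOr d xs o
lookupOr-clamp d []       o       = refl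
lookupOr-clamp d (x ∷ xs) zero    = refl
lookupOr-clamp d (x ∷ xs) (suc o) = lookupOr-clamp d xs o

clamp-suc : ∀ n o → clamp n (suc (toℕ (clamp n o))) ≡ clamp n (suc o)
clamp-suc n       zero    = refl
clamp-suc zero    (suc o) = refl
clamp-suc (suc n) (suc o) = cong Fin.suc (clamp-suc n o)

-- A program is a list of blocks.  'go d a' performs the pebble action a, moves
-- through port d and proceeds to the next instruction; 'test k₁ k₂' steps north
-- and jumps to block k₁ if the node it left holds a pebble, to block k₂ otherwise.
data Instr : Set where
  go   : Port → Action → Instr
  test : ℕ → ℕ → Instr

instrAt : List Instr → ℕ → Instr
instrAt = lookupOr (go N none)

Loaded : List Instr → ℕ → List Instr → Set
Loaded prog o []         = ⊤
Loaded prog o (i ∷ code) = instrAt prog o ≡ i × Loaded prog (suc o) code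

loaded-∷ : ∀ i {prog o} code → Loaded prog o code → Loaded (i ∷ prog) (suc o) code
loaded-∷ i []           tt       = tt
loaded-∷ i (j ∷ code) (e , ℓ) = e , loaded-∷ i code ℓ

loaded-++ʳ : ∀ pre {prog o} code → Loaded prog o code → Loaded (pre ++ prog) (length pre ℕ.+ o) code
loaded-++ʳ []        code ℓ = ℓ
loaded-++ʳ (i ∷ pre) code ℓ = loaded-∷ i code (loaded-++ʳ pre code ℓ)

loaded-++ˡ : ∀ code rest → Loaded (code ++ rest) 0 code
loaded-++ˡ []         rest = tt
loaded-++ˡ (i ∷ code) rest = refl , loaded-∷ i code (loaded-++ˡ code rest)

loaded-block : ∀ blocks k → Loaded (concat blocks) (length (concat (take k blocks))) (lookupOr [] blocks k)
loaded-block []           k       = tt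
loaded-block (b ∷ blocks) zero    = loaded-++ˡ b (concat blocks)
loaded-block (b ∷ blocks) (suc k) =
  subst (λ o → Loaded (b ++ concat blocks) o (lookupOr [] blocks k)) (sym (ListP.length-++ b))
        (loaded-++ʳ b (lookupOr [] blocks k) (loaded-block blocks k))

moves : List Port → List Instr
moves = map (λ d → go d none)

dropHere pickHere : List Instr
dropHere = go N drop ∷ go S none ∷ []
pickHere = go N pick ∷ go S none ∷ []

module Machine (p : ℕ) (blocks : List (List Instr)) where

  prog : List Instr
  prog = concat blocks

  pc : ℕ → Fin (suc (length prog))
  pc = clamp (length prog)

  entry : ℕ → ℕ
  entry k = length (concat (take k blocks))

  block : ℕ → List Instr
  block = lookupOr [] blocks

  exec : Fin (suc (length prog)) → Instr → Bool → Port × Action × Fin (suc (length prog))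
  exec q (go d a)     b = d , a , pc (suc (toℕ q))
  exec q (test k₁ k₂) b = N , none , pc (entry (if b then k₁ else k₂))

  machine : Automaton p
  machine = record
    { nStates = suc (length prog)
    ; init    = pc 0
    ; δ       = λ q b _ → exec q (instrAt prog (toℕ q)) b
    }

  δ-pc : ∀ o b c → δ machine (pc o) b c ≡ exec (pc o) (instrAt prog o) b
  δ-pc o b c = cong (λ i → exec (pc o) i b) (lookupOr-clamp (go N none) prog o)

  Agent : Set
  Agent = Config machine

  step-go : ∀ {o d u f n} → instrAt prog o ≡ go d none →
            step machine (cfg u (pc o) f n) ≡ cfg (move d u) (pc (suc o)) f n
  step-go {o} {u = u} {f} {n} e rewrite δ-pc o (f u) (clamp p n) | e | clamp-suc (length prog) o = refl

  step-drop : ∀ {o d u f n} → instrAt prog o ≡ go d drop → f u ≡ false →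
              step machine (cfg u (pc o) f (suc n)) ≡ cfg (move d u) (pc (suc o)) (set f u true) n
  step-drop {o} {u = u} {f} {n} e fu rewrite δ-pc o (f u) (clamp p (suc n)) | e | fu | clamp-suc (length prog) o = refl

  step-pick : ∀ {o d u f n} → instrAt prog o ≡ go d pick → f u ≡ true →
              step machine (cfg u (pc o) f n) ≡ cfg (move d u) (pc (suc o)) (set f u false) (suc n)
  step-pick {o} {u = u} {f} {n} e fu rewrite δ-pc o (f u) (clamp p n) | e | fu | clamp-suc (length prog) o = refl

  step-test : ∀ {o k₁ k₂ u f n} → instrAt prog o ≡ test k₁ k₂ →
              step machine (cfg u (pc o) f n) ≡ cfg (move N u) (pc (entry (if f u then k₁ else k₂))) f n
  step-test {o} {u = u} {f} {n} e rewrite δ-pc o (f u) (clamp p n) | e = refl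

  _↝_ : Agent → Agent → Set
  c ↝ c′ = ∃ λ k → iter k (step machine) c ≡ c′

  ↝-step : ∀ {c c′ c″} → c ↝ c′ → step machine c′ ≡ c″ → c ↝ c″
  ↝-step (k , e) e′ = suc k , trans (cong (step machine) e) e′

  Visits : Agent → Point → Set
  Visits c v = ∃ λ k → pos (iter k (step machine) c) ≡ v

  Running : Agent → Point → (Point → Bool) → ℕ → List Instr → Set
  Running c u f n code = ∃ λ o → Loaded prog o code × c ↝ cfg u (pc o) f n

  start : ∀ u → Running (cfg u (pc 0) (λ _ → false) p) u (λ _ → false) p (block 0)
  start u = 0 , loaded-block blocks 0 , 0 , refl

  run-visits : ∀ {c u f n code} → Running c u f n code → Visits c u
  run-visits (_ , _ , k , e) = k , cong pos e

  run-go : ∀ {c u f n d code} → Running c u f n (go d none ∷ code) → Running c (move d u) f n code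
  run-go (o , (e , ℓ) , r) = suc o , ℓ , ↝-step r (step-go e)

  run-moves : ∀ {c u f n code} ps → Running c u f n (moves ps ++ code) → Running c (walk u ps) f n code
  run-moves []       ρ = ρ
  run-moves (d ∷ ps) ρ = run-moves ps (run-go ρ)

  run-passes : ∀ {c u f n code ps v} → Running c u f n (moves ps ++ code) → Passes u ps v → Visits c v
  run-passes ρ here                   = run-visits ρ
  run-passes ρ (there {ps = ps} π)    = run-passes {ps = ps} (run-go ρ) π

  run-drop : ∀ {c u f n code} → Running c u f (suc n) (dropHere ++ code) → f u ≡ false →
             Running c u (set f u true) n code
  run-drop {u = u} {f} {n} (o , (e₁ , e₂ , ℓ) , r) fu =
    suc (suc o) , ℓ , ↝-step (↝-step r (step-drop e₁ fu))
                             (trans (step-go e₂) (cong (λ v → cfg v (pc (suc (suc o))) (set f u true) n) (move-S-N u)))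

  run-pick : ∀ {c u f n code} → Running c u f n (pickHere ++ code) → f u ≡ true →
             Running c u (set f u false) (suc n) code
  run-pick {u = u} {f} {n} (o , (e₁ , e₂ , ℓ) , r) fu =
    suc (suc o) , ℓ , ↝-step (↝-step r (step-pick e₁ fu))
                             (trans (step-go e₂) (cong (λ v → cfg v (pc (suc (suc o))) (set f u false) (suc n)) (move-S-N u)))

  run-test : ∀ {c u f n k₁ k₂ code} → Running c u f n (test k₁ k₂ ∷ code) →
             Running c (move N u) f n (block (if f u then k₁ else k₂))
  run-test {u = u} {f = f} {k₁ = k₁} {k₂ = k₂} (o , (e , _) , r) =
    entry k , loaded-block blocks k , ↝-step r (step-test e)
    where k = if f u then k₁ else k₂

  run-found : ∀ {c u f n k₁ k₂ code} → f u ≡ true → Running c u f n (test k₁ k₂ ∷ code) →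
              Running c (move N u) f n (block k₁)
  run-found {c} {u} {f} {n} {k₁} {k₂} fu ρ = subst (λ b → Running c (move N u) f n (block (if b then k₁ else k₂))) fu (run-test ρ)

  run-notFound : ∀ {c u f n k₁ k₂ code} → f u ≡ false → Running c u f n (test k₁ k₂ ∷ code) →
                 Running c (move N u) f n (block k₂)
  run-notFound {c} {u} {f} {n} {k₁} {k₂} fu ρ = subst (λ b → Running c (move N u) f n (block (if b then k₁ else k₂))) fu (run-test ρ)

  run-return : ∀ {c u f n code} → Running c (move N u) f n (go S none ∷ code) → Running c u f n code
  run-return {c} {u} {f} {n} {code} ρ = subst (λ v → Running c v f n code) (move-S-N u) (run-go ρ)

isAt : Point → Point → Bool
isAt a v = does (v ≟ᵥ a)

PebblesOn₁ : (Point → Bool) → Point → Set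
PebblesOn₁ f a = ∀ v → f v ≡ isAt a v

PebblesOn₂ : (Point → Bool) → Point → Point → Set
PebblesOn₂ f a b = ∀ v → f v ≡ isAt a v ∨ isAt b v

isAt-self : ∀ a → isAt a a ≡ true
isAt-self a with a ≟ᵥ a
... | yes _  = refl
... | no a≢a = ⊥-elim (a≢a refl)

isAt-≢ : ∀ {a v} → v ≢ a → isAt a v ≡ false
isAt-≢ {a} {v} v≢a with v ≟ᵥ a
... | yes v≡a = ⊥-elim (v≢a v≡a)
... | no _    = refl

pebblesOn₁-first : ∀ a → PebblesOn₁ (set (λ _ → false) a true) a
pebblesOn₁-first a v with v ≟ᵥ a
... | yes _ = refl
... | no _  = refl

pebblesOn₂-drop : ∀ {f a b} → PebblesOn₁ f b → PebblesOn₂ (set f a true) a b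
pebblesOn₂-drop {f} {a} {b} on v with v ≟ᵥ a
... | yes _ = refl
... | no _  = on v

pebblesOn₂-pick : ∀ {f a b} → PebblesOn₂ f a b → a ≢ b → PebblesOn₁ (set f b false) a
pebblesOn₂-pick {f} {a} {b} on a≢b v with v ≟ᵥ b
... | yes refl = sym (isAt-≢ (λ b≡a → a≢b (sym b≡a)))
... | no v≢b   = trans (on v) (trans (cong (isAt a v ∨_) (isAt-≢ v≢b)) (BoolP.∨-identityʳ (isAt a v)))

pebble₂ : ∀ {f a b} → PebblesOn₂ f a b → f b ≡ true
pebble₂ {f} {a} {b} on = trans (on b) (trans (cong (isAt a b ∨_) (isAt-self b)) (BoolP.∨-zeroʳ (isAt a b)))

no-pebble₁ : ∀ {f a v} → PebblesOn₁ f a → v ≢ a → f v ≡ false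
no-pebble₁ {v = v} on v≢a = trans (on v) (isAt-≢ v≢a)

no-pebble₂ : ∀ {f a b v} → PebblesOn₂ f a b → v ≢ a → v ≢ b → f v ≡ false
no-pebble₂ {v = v} on v≢a v≢b = trans (on v) (cong₂ _∨_ (isAt-≢ v≢a) (isAt-≢ v≢b))

-- The lattice spanned by two independent vectors

cross : Point → Point → ℤ
cross (a , b) (c , d) = a ℤ.* d ℤ.- b ℤ.* c

module Lattice (O R₁ R₂ : Point) (independent : cross R₁ R₂ ≢ + 0) where

  lat : ℤ → ℤ → Point
  lat a b = a ·ᵥ R₁ +ᵥ b ·ᵥ R₂

  opaque
    latticePoint : ℤ → ℤ → Point
    latticePoint a b = O +ᵥ lat a b

    latticePoint-+ : ∀ a b c d → latticePoint a b +ᵥ lat c d ≡ latticePoint (c ℤ.+ a) (d ℤ.+ b)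
    latticePoint-+ a b c d = cong₂ _,_ (ring a b c d (proj₁ O) (proj₁ R₁) (proj₁ R₂)) (ring a b c d (proj₂ O) (proj₂ R₁) (proj₂ R₂))
      where
      ring : ∀ a b c d o r s → o ℤ.+ (a ℤ.* r ℤ.+ b ℤ.* s) ℤ.+ (c ℤ.* r ℤ.+ d ℤ.* s) ≡ o ℤ.+ ((c ℤ.+ a) ℤ.* r ℤ.+ (d ℤ.+ b) ℤ.* s)
      ring = solve-∀

    cross-first : ∀ a b → cross (latticePoint a b) R₂ ℤ.- cross O R₂ ≡ a ℤ.* cross R₁ R₂
    cross-first a b = ring a b (proj₁ O) (proj₂ O) (proj₁ R₁) (proj₂ R₁) (proj₁ R₂) (proj₂ R₂)
      where
      ring : ∀ a b o₁ o₂ r₁ r₂ s₁ s₂ → (o₁ ℤ.+ (a ℤ.* r₁ ℤ.+ b ℤ.* s₁)) ℤ.* s₂ ℤ.- (o₂ ℤ.+ (a ℤ.* r₂ ℤ.+ b ℤ.* s₂)) ℤ.* s₁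
                                     ℤ.- (o₁ ℤ.* s₂ ℤ.- o₂ ℤ.* s₁) ≡ a ℤ.* (r₁ ℤ.* s₂ ℤ.- r₂ ℤ.* s₁)
      ring = solve-∀

    cross-second : ∀ a b → cross R₁ (latticePoint a b) ℤ.- cross R₁ O ≡ b ℤ.* cross R₁ R₂
    cross-second a b = ring a b (proj₁ O) (proj₂ O) (proj₁ R₁) (proj₂ R₁) (proj₁ R₂) (proj₂ R₂)
      where
      ring : ∀ a b o₁ o₂ r₁ r₂ s₁ s₂ → r₁ ℤ.* (o₂ ℤ.+ (a ℤ.* r₂ ℤ.+ b ℤ.* s₂)) ℤ.- r₂ ℤ.* (o₁ ℤ.+ (a ℤ.* r₁ ℤ.+ b ℤ.* s₁))
                                     ℤ.- (r₁ ℤ.* o₂ ℤ.- r₂ ℤ.* o₁) ≡ b ℤ.* (r₁ ℤ.* s₂ ℤ.- r₂ ℤ.* s₁)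
      ring = solve-∀

    latticePoint-0-0 : latticePoint (+ 0) (+ 0) ≡ O
    latticePoint-0-0 = cong₂ _,_ (ℤP.+-identityʳ (proj₁ O)) (ℤP.+-identityʳ (proj₂ O))

    latticePoint-definition : ∀ a b → latticePoint a b ≡ O +ᵥ lat a b
    latticePoint-definition a b = refl

  pt : ℕ → ℕ → Point
  pt i j = latticePoint (+ i) (+ j)

  pt-+ : ∀ {i j i′ j′} a b → a ℤ.+ + i ≡ + i′ → b ℤ.+ + j ≡ + j′ → pt i j +ᵥ lat a b ≡ pt i′ j′
  pt-+ {i} {j} a b ei ej = trans (latticePoint-+ (+ i) (+ j) a b) (cong₂ latticePoint ei ej)

  pt-injective : ∀ {i j i′ j′} → pt i j ≡ pt i′ j′ → i ≡ i′ × j ≡ j′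
  pt-injective {i} {j} {i′} {j′} e =
      coefficient (trans (sym (cross-first (+ i) (+ j))) (trans (cong (λ v → cross v R₂ ℤ.- cross O R₂) e) (cross-first (+ i′) (+ j′))))
    , coefficient (trans (sym (cross-second (+ i) (+ j))) (trans (cong (λ v → cross R₁ v ℤ.- cross R₁ O) e) (cross-second (+ i′) (+ j′))))
    where
    instance _ = ℤ.≢-nonZero independent
    coefficient : ∀ {m n} → + m ℤ.* cross R₁ R₂ ≡ + n ℤ.* cross R₁ R₂ → m ≡ n
    coefficient {m} {n} e = ℤP.+-injective (ℤP.*-cancelʳ-≡ (+ m) (+ n) (cross R₁ R₂) e)

  pt-≢ˡ : ∀ {i j i′ j′} → i ≢ i′ → pt i j ≢ pt i′ j′
  pt-≢ˡ {i} {j} {i′} {j′} i≢i′ e = i≢i′ (proj₁ (pt-injective {i} {j} {i′} {j′} e))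

  pt-≢ʳ : ∀ {i j i′ j′} → j ≢ j′ → pt i j ≢ pt i′ j′
  pt-≢ʳ {i} {j} {i′} {j′} j≢j′ e = j≢j′ (proj₂ (pt-injective {i} {j} {i′} {j′} e))

-- Sweeping the lattice diagonal by diagonal

module Sweep (O R₁ R₂ : Point) (independent : cross R₁ R₂ ≢ + 0) (Rad : ℕ) where

  open Lattice O R₁ R₂ independent public

  toLat : ℤ → ℤ → List Instr
  toLat a b = moves (straight (lat a b))

  surveyHere : List Instr
  surveyHere = moves (survey Rad)

  -- Blocks 0 to 4: start, forward step, forward turn, backward step, backward turn.
  blocks : List (List Instr)
  blocks =
      (surveyHere ++ toLat (+ 0) (+ 1) ++ dropHere ++ toLat (+ 1) -[1+ 0 ] ++ dropHere ++
       surveyHere ++ toLat -[1+ 0 ] (+ 1) ++ test 2 1 ∷ [])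
    ∷ (go S none ∷ surveyHere ++ toLat -[1+ 0 ] (+ 1) ++ test 2 1 ∷ [])
    ∷ (go S none ∷ surveyHere ++ pickHere ++ toLat (+ 0) (+ 1) ++ dropHere ++ toLat (+ 1) -[1+ 1 ] ++ test 4 3 ∷ [])
    ∷ (go S none ∷ toLat (+ 1) -[1+ 0 ] ++ test 4 3 ∷ [])
    ∷ (go S none ∷ pickHere ++ toLat (+ 1) (+ 0) ++ dropHere ++ surveyHere ++ toLat -[1+ 0 ] (+ 1) ++ test 2 1 ∷ [])
    ∷ []

  open Machine 2 blocks public

  c₀ : Agent
  c₀ = cfg O (pc 0) (λ _ → false) 2

  Covered : Agent → Point → Set
  Covered c u = ∀ d → Within Rad d → Visits c (u +ᵥ d)

  run-survey : ∀ {c u f n code} → Running c u f n (surveyHere ++ code) → Covered c u × Running c u f n code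
  run-survey {c} {u} {f} {n} {code} ρ =
      (λ d d≤ → run-passes {ps = survey Rad} ρ (passes-survey u d d≤))
    , subst (λ v → Running c v f n code) (walk-survey Rad u) (run-moves (survey Rad) ρ)

  run-toLat : ∀ {c f n code i j i′ j′} a b → a ℤ.+ + i ≡ + i′ → b ℤ.+ + j ≡ + j′ →
              Running c (pt i j) f n (toLat a b ++ code) → Running c (pt i′ j′) f n code
  run-toLat {c} {f} {n} {code} {i} {j} a b ei ej ρ =
    subst (λ v → Running c v f n code) (trans (walk-straight (pt i j) (lat a b)) (pt-+ a b ei ej))
          (run-moves (straight (lat a b)) ρ)

  -- While the diagonal i + j = K + 1 is swept forward the pebbles mark its two
  -- ends; on the way back the one at (0, K + 1) has already moved to (0, K + 2).
  Forward : Agent → ℕ → Point → Set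
  Forward c K u = Σ (Point → Bool) λ f → Running c u f 0 (test 2 1 ∷ []) × PebblesOn₂ f (pt (suc K) 0) (pt 0 (suc K))

  Backward : Agent → ℕ → Point → Set
  Backward c K u = Σ (Point → Bool) λ f → Running c u f 0 (test 4 3 ∷ []) × PebblesOn₂ f (pt 0 (suc (suc K))) (pt (suc K) 0)

  forward-step : ∀ {c K i j} → Forward c K (pt (suc i) (suc j)) →
                 Covered c (pt (suc i) (suc j)) × Forward c K (pt i (suc (suc j)))
  forward-step (f , ρ , on) = proj₁ σ , f , run-toLat -[1+ 0 ] (+ 1) refl refl (proj₂ σ) , on
    where
    σ = run-survey (run-return (run-notFound (no-pebble₂ on (pt-≢ʳ λ ()) (pt-≢ˡ λ ())) ρ))

  forward-turn : ∀ {c K} → Forward c K (pt 0 (suc K)) → Covered c (pt 0 (suc K)) × Backward c K (pt 1 K)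
  forward-turn (f , ρ , on) =
    proj₁ σ , _ , run-toLat (+ 1) -[1+ 1 ] refl refl (run-drop ρ₁ (no-pebble₁ on₁ (pt-≢ʳ λ ()))) , pebblesOn₂-drop on₁
    where
    σ   = run-survey (run-return (run-found (pebble₂ on) ρ))
    on₁ = pebblesOn₂-pick on (pt-≢ˡ λ ())
    ρ₁  = run-toLat (+ 0) (+ 1) refl refl (run-pick (proj₂ σ) (pebble₂ on))

  backward-step : ∀ {c K i j} → Backward c K (pt (suc i) (suc j)) → Backward c K (pt (suc (suc i)) j)
  backward-step (f , ρ , on) =
    f , run-toLat (+ 1) -[1+ 0 ] refl refl (run-return (run-notFound (no-pebble₂ on (pt-≢ˡ λ ()) (pt-≢ʳ λ ())) ρ)) , on

  backward-turn : ∀ {c K} → Backward c K (pt (suc K) 0) →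
                  Covered c (pt (suc (suc K)) 0) × Forward c (suc K) (pt (suc K) 1)
  backward-turn (f , ρ , on) = proj₁ σ , _ , run-toLat -[1+ 0 ] (+ 1) refl refl (proj₂ σ) , pebblesOn₂-drop on₁
    where
    on₁ = pebblesOn₂-pick on (pt-≢ˡ λ ())
    ρ₁  = run-toLat (+ 1) (+ 0) refl refl (run-pick (run-return (run-found (pebble₂ on) ρ)) (pebble₂ on))
    σ   = run-survey (run-drop ρ₁ (no-pebble₁ on₁ (pt-≢ˡ λ ())))

  opening : Covered c₀ (pt 0 0) × Covered c₀ (pt 1 0) × Forward c₀ 0 (pt 0 1)
  opening = proj₁ σ₀ , proj₁ σ₁ , _ , run-toLat -[1+ 0 ] (+ 1) refl refl (proj₂ σ₁) , pebblesOn₂-drop on₁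
    where
    σ₀  = run-survey (subst (λ v → Running c₀ v (λ _ → false) 2 (block 0)) (sym latticePoint-0-0) (start O))
    on₁ = pebblesOn₁-first (pt 0 1)
    ρ₁  = run-toLat (+ 1) -[1+ 0 ] refl refl (run-drop (run-toLat (+ 0) (+ 1) refl refl (proj₂ σ₀)) refl)
    σ₁  = run-survey (run-drop ρ₁ (no-pebble₁ on₁ (pt-≢ˡ λ ())))

  forward-pass : ∀ {c} K i j → i ℕ.+ j ≡ K → Forward c K (pt i (suc j)) →
                 (∀ i′ j′ → i′ ℕ.+ j′ ≡ i → Covered c (pt i′ (suc j ℕ.+ j′))) × Backward c K (pt 1 K)
  forward-pass {c} K zero j refl φ = covered , proj₂ (forward-turn φ)
    where
    covered : ∀ i′ j′ → i′ ℕ.+ j′ ≡ 0 → Covered c (pt i′ (suc j ℕ.+ j′))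
    covered zero zero refl = subst (λ j′ → Covered c (pt 0 j′)) (sym (ℕP.+-identityʳ (suc j))) (proj₁ (forward-turn φ))
  forward-pass {c} K (suc i) j i+j≡K φ = covered , proj₂ rest
    where
    now  = forward-step φ
    rest = forward-pass K i (suc j) (trans (ℕP.+-suc i j) i+j≡K) (proj₂ now)
    covered : ∀ i′ j′ → i′ ℕ.+ j′ ≡ suc i → Covered c (pt i′ (suc j ℕ.+ j′))
    covered i′ zero    e = subst₂ (λ i″ j″ → Covered c (pt i″ j″)) (trans (sym e) (ℕP.+-identityʳ i′))
                                  (sym (ℕP.+-identityʳ (suc j))) (proj₁ now)
    covered i′ (suc j′) e = subst (λ j″ → Covered c (pt i′ j″)) (sym (ℕP.+-suc (suc j) j′))
                                  (proj₁ rest i′ j′ (ℕP.suc-injective (trans (sym (ℕP.+-suc i′ j′)) e)))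

  backward-pass : ∀ {c} K i j → i ℕ.+ j ≡ K → Backward c K (pt (suc i) j) → Backward c K (pt (suc K) 0)
  backward-pass K i zero    i+0≡K β = subst (λ k → Backward _ K (pt (suc k) 0)) (trans (sym (ℕP.+-identityʳ i)) i+0≡K) β
  backward-pass K i (suc j) i+j≡K β = backward-pass K (suc i) j (trans (sym (ℕP.+-suc i j)) i+j≡K) (backward-step β)

  sweep : ∀ K → Covered c₀ (pt (suc K) 0) × Forward c₀ K (pt K 1)
  sweep zero    = proj₁ (proj₂ opening) , proj₂ (proj₂ opening)
  sweep (suc K) = backward-turn (backward-pass K 0 K refl (proj₂ (forward-pass K K 0 (ℕP.+-identityʳ K) (proj₂ (sweep K)))))

  covers-lattice : ∀ i j → Covered c₀ (pt i j)
  covers-lattice zero    zero    = proj₁ opening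
  covers-lattice (suc i) zero    = proj₁ (sweep i)
  covers-lattice i       (suc j) = proj₁ (forward-pass (i ℕ.+ j) (i ℕ.+ j) 0 (ℕP.+-identityʳ _) (proj₂ (sweep (i ℕ.+ j)))) i j refl

-- Integer points of a cone lie near the lattice spanned by its edges

size : Point → ℕ
size (a , b) = ∣ a ∣ ℕ.+ ∣ b ∣

cramer : ∀ r₁ r₂ v → cross r₁ r₂ ·ᵥ v ≡ cross v r₂ ·ᵥ r₁ +ᵥ cross r₁ v ·ᵥ r₂
cramer (a , b) (c , d) (x , y) = cong₂ _,_ (ring-x a b c d x y) (ring-y a b c d x y)
  where
  ring-x : ∀ a b c d x y → (a ℤ.* d ℤ.- b ℤ.* c) ℤ.* x ≡ (x ℤ.* d ℤ.- y ℤ.* c) ℤ.* a ℤ.+ (a ℤ.* y ℤ.- b ℤ.* x) ℤ.* c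
  ring-x = solve-∀
  ring-y : ∀ a b c d x y → (a ℤ.* d ℤ.- b ℤ.* c) ℤ.* y ≡ (x ℤ.* d ℤ.- y ℤ.* c) ℤ.* b ℤ.+ (a ℤ.* y ℤ.- b ℤ.* x) ℤ.* d
  ring-y = solve-∀

divMod : ∀ D u → + 0 ℤ.≤ u → ∃ λ q → ∃ λ ρ → ρ ℕ.< suc D × u ≡ + ρ ℤ.+ + q ℤ.* + suc D
divMod D (+ n) _ = n / suc D , n % suc D , m%n<n n (suc D) ,
  trans (cong +_ (m≡m%n+[m/n]*n n (suc D))) (cong (λ k → + (n % suc D) ℤ.+ k) (ℤP.pos-* (n / suc D) (suc D)))

remainder-identity : ∀ s x a b A B ρ₁ ρ₂ → s ℤ.* x ≡ (ρ₁ ℤ.+ A ℤ.* s) ℤ.* a ℤ.+ (ρ₂ ℤ.+ B ℤ.* s) ℤ.* b →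
                     s ℤ.* (x ℤ.- (A ℤ.* a ℤ.+ B ℤ.* b)) ≡ ρ₁ ℤ.* a ℤ.+ ρ₂ ℤ.* b
remainder-identity s x a b A B ρ₁ ρ₂ e = begin
  s ℤ.* (x ℤ.- (A ℤ.* a ℤ.+ B ℤ.* b))                               ≡⟨ expand s x a b A B ⟩
  s ℤ.* x ℤ.- s ℤ.* (A ℤ.* a ℤ.+ B ℤ.* b)                           ≡⟨ cong (λ t → t ℤ.- s ℤ.* (A ℤ.* a ℤ.+ B ℤ.* b)) e ⟩
  (ρ₁ ℤ.+ A ℤ.* s) ℤ.* a ℤ.+ (ρ₂ ℤ.+ B ℤ.* s) ℤ.* b ℤ.- s ℤ.* (A ℤ.* a ℤ.+ B ℤ.* b) ≡⟨ collect s a b A B ρ₁ ρ₂ ⟩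
  ρ₁ ℤ.* a ℤ.+ ρ₂ ℤ.* b                                              ∎
  where
  open ≡-Reasoning
  expand : ∀ s x a b A B → s ℤ.* (x ℤ.- (A ℤ.* a ℤ.+ B ℤ.* b)) ≡ s ℤ.* x ℤ.- s ℤ.* (A ℤ.* a ℤ.+ B ℤ.* b)
  expand = solve-∀
  collect : ∀ s a b A B ρ₁ ρ₂ →
            (ρ₁ ℤ.+ A ℤ.* s) ℤ.* a ℤ.+ (ρ₂ ℤ.+ B ℤ.* s) ℤ.* b ℤ.- s ℤ.* (A ℤ.* a ℤ.+ B ℤ.* b) ≡ ρ₁ ℤ.* a ℤ.+ ρ₂ ℤ.* b
  collect = solve-∀

remainder-bound : ∀ {D ρ₁ ρ₂} a b z → ρ₁ ℕ.< suc D → ρ₂ ℕ.< suc D →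
                  + suc D ℤ.* z ≡ + ρ₁ ℤ.* a ℤ.+ + ρ₂ ℤ.* b → ∣ z ∣ ℕ.≤ ∣ a ∣ ℕ.+ ∣ b ∣
remainder-bound {D} {ρ₁} {ρ₂} a b z ρ₁<D ρ₂<D e = ℕP.*-cancelˡ-≤ (suc D) (begin
  suc D ℕ.* ∣ z ∣                         ≡⟨ ℤP.abs-* (+ suc D) z ⟨
  ∣ + suc D ℤ.* z ∣                       ≡⟨ cong ∣_∣ e ⟩
  ∣ + ρ₁ ℤ.* a ℤ.+ + ρ₂ ℤ.* b ∣           ≤⟨ ℤP.∣i+j∣≤∣i∣+∣j∣ (+ ρ₁ ℤ.* a) (+ ρ₂ ℤ.* b) ⟩
  ∣ + ρ₁ ℤ.* a ∣ ℕ.+ ∣ + ρ₂ ℤ.* b ∣       ≡⟨ cong₂ ℕ._+_ (ℤP.abs-* (+ ρ₁) a) (ℤP.abs-* (+ ρ₂) b) ⟩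
  ρ₁ ℕ.* ∣ a ∣ ℕ.+ ρ₂ ℕ.* ∣ b ∣           ≤⟨ ℕP.+-mono-≤ (ℕP.*-monoˡ-≤ ∣ a ∣ (ℕP.<⇒≤ ρ₁<D)) (ℕP.*-monoˡ-≤ ∣ b ∣ (ℕP.<⇒≤ ρ₂<D)) ⟩
  suc D ℕ.* ∣ a ∣ ℕ.+ suc D ℕ.* ∣ b ∣     ≡⟨ ℕP.*-distribˡ-+ (suc D) ∣ a ∣ ∣ b ∣ ⟨
  suc D ℕ.* (∣ a ∣ ℕ.+ ∣ b ∣)             ∎)
  where open ℕP.≤-Reasoning

positive : ∀ {i} → + 0 ℤ.< i → ∃ λ D → i ≡ + suc D
positive {+[1+ D ]} _ = D , refl
positive {+ 0} (ℤ.+<+ ())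

cone-near-lattice : ∀ r₁ r₂ v → + 0 ℤ.< cross r₁ r₂ → + 0 ℤ.≤ cross v r₂ → + 0 ℤ.≤ cross r₁ v →
                    ∃ λ A → ∃ λ B → Within (size r₁ ℕ.+ size r₂) (v -ᵥ (+ A ·ᵥ r₁ +ᵥ + B ·ᵥ r₂))
cone-near-lattice r₁@(a , b) r₂@(c , d) v 0<Δ 0≤u 0≤w with positive 0<Δ
... | D , Δ≡ with divMod D (cross v r₂) 0≤u | divMod D (cross r₁ v) 0≤w
...   | A , ρ₁ , ρ₁<Δ , u≡ | B , ρ₂ , ρ₂<Δ , w≡ =
  A , B , ℕP.≤-trans (near (cong proj₁ Δv≡)) (ℕP.+-mono-≤ (ℕP.m≤m+n ∣ a ∣ ∣ b ∣) (ℕP.m≤m+n ∣ c ∣ ∣ d ∣))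
        , ℕP.≤-trans (near (cong proj₂ Δv≡)) (ℕP.+-mono-≤ (ℕP.m≤n+m ∣ b ∣ ∣ a ∣) (ℕP.m≤n+m ∣ d ∣ ∣ c ∣))
  where
  Δv≡ : + suc D ·ᵥ v ≡ cross v r₂ ·ᵥ r₁ +ᵥ cross r₁ v ·ᵥ r₂
  Δv≡ = subst (λ Δ → Δ ·ᵥ v ≡ cross v r₂ ·ᵥ r₁ +ᵥ cross r₁ v ·ᵥ r₂) Δ≡ (cramer r₁ r₂ v)
  near : ∀ {x e f} → + suc D ℤ.* x ≡ cross v r₂ ℤ.* e ℤ.+ cross r₁ v ℤ.* f →
         ∣ x ℤ.- (+ A ℤ.* e ℤ.+ + B ℤ.* f) ∣ ℕ.≤ ∣ e ∣ ℕ.+ ∣ f ∣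
  near {x} {e} {f} Δx≡ = remainder-bound e f _ ρ₁<Δ ρ₂<Δ
    (remainder-identity (+ suc D) x e f (+ A) (+ B) (+ ρ₁) (+ ρ₂) (trans Δx≡ (cong₂ (λ u w → u ℤ.* e ℤ.+ w ℤ.* f) u≡ w≡)))

sgn-squared : ∀ s → sgn s ℤ.* sgn s ≡ + 1
sgn-squared plus  = refl
sgn-squared minus = refl

∣sgn*∣ : ∀ s z → ∣ sgn s ℤ.* z ∣ ≡ ∣ z ∣
∣sgn*∣ plus  z = cong ∣_∣ (ℤP.*-identityˡ z)
∣sgn*∣ minus z = trans (cong ∣_∣ (ℤP.-1*i≡-i z)) (ℤP.∣-i∣≡∣i∣ z)

sgn-flip : ∀ s z → sgn (flip s) ℤ.* z ≡ ℤ.- (sgn s ℤ.* z)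
sgn-flip plus  z = trans (ℤP.-1*i≡-i z) (cong ℤ.-_ (sym (ℤP.*-identityˡ z)))
sgn-flip minus z = trans (ℤP.*-identityˡ z) (trans (sym (ℤP.neg-involutive z)) (cong ℤ.-_ (sym (ℤP.-1*i≡-i z))))

-- In the coordinates (σy·x, σx·y) both boundaries of a wedge become lines Y = t·(X + Y).
mirror : Sgn → Sgn → Point → Point
mirror sx sy (x , y) = (sgn sy ℤ.* x , sgn sx ℤ.* y)

Below : ℝ → Point → Set
Below t (X , Y) = LeMul Y (Y ℤ.+ X) t

BelowSlope : ℚ → Point → Set
BelowSlope q (X , Y) = Y ℤ.* ↧ q ℤ.≤ ↥ q ℤ.* (Y ℤ.+ X)

mulLe-neg : ∀ A S t → MulLe (ℤ.- A) (ℤ.- S) t → LeMul A S t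
mulLe-neg A (+ zero)   t 0≤-A = subst (ℤ._≤ + 0) (ℤP.neg-involutive A) (ℤP.neg-mono-≤ 0≤-A)
mulLe-neg A +[1+ n ]   t h    = subst (λ z → (z ℚ./ suc n) ℚ≤ℝ t) (ℤP.neg-involutive A) h
mulLe-neg A -[1+ n ]   t h    = h

wedgeCoords : OppWedge → Point → Point
wedgeCoords w v = mirror (σx (d₁ w)) (σy (d₁ w)) (v -ᵥ O w)

inWedge⇒below : ∀ w v → InWedge w v → Below (t (d₁ w)) (wedgeCoords w v) × Below (t (d₂ w)) (wedgeCoords w v)
inWedge⇒below w v (below₁ , above₂) = below₁ , mulLe-neg Y (Y ℤ.+ X) (t (d₂ w)) (subst₂ (λ a s → MulLe a s (t (d₂ w))) flip-A flip-S flipped)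
  where
  x = proj₁ (v -ᵥ O w)
  y = proj₂ (v -ᵥ O w)
  X = sgn (σy (d₁ w)) ℤ.* x
  Y = sgn (σx (d₁ w)) ℤ.* y
  flipped : MulLe (sgn (flip (σx (d₁ w))) ℤ.* y) (sgn (flip (σx (d₁ w))) ℤ.* y ℤ.+ sgn (flip (σy (d₁ w))) ℤ.* x) (t (d₂ w))
  flipped = subst₂ (λ sx sy → MulLe (sgn sx ℤ.* y) (sgn sx ℤ.* y ℤ.+ sgn sy ℤ.* x) (t (d₂ w))) (opp-x w) (opp-y w) above₂
  flip-A : sgn (flip (σx (d₁ w))) ℤ.* y ≡ ℤ.- Y
  flip-A = sgn-flip (σx (d₁ w)) y
  flip-S : sgn (flip (σx (d₁ w))) ℤ.* y ℤ.+ sgn (flip (σy (d₁ w))) ℤ.* x ≡ ℤ.- (Y ℤ.+ X)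
  flip-S = trans (cong₂ ℤ._+_ flip-A (sgn-flip (σy (d₁ w)) x)) (sym (ℤP.neg-distrib-+ Y X))

small⇒ordered : ∀ w → Small w → (t (d₁ w) ℝ<ℝ t (d₂ w)) ⊎ (t (d₂ w) ℝ<ℝ t (d₁ w))
small⇒ordered w small with σx (d₁ w) | σy (d₁ w)
... | plus  | plus  = inj₁ small
... | minus | minus = inj₁ small
... | plus  | minus = inj₂ small
... | minus | plus  = inj₂ small

module Fraction (i : ℤ) (n : ℕ) .{{_ : ℕ.NonZero n}} where

  private
    g = gcd i (+ n)

    numerator : ∀ a → ↥ (i ℚ./ n) ℤ.* a ℤ.* g ≡ i ℤ.* a
    numerator a = trans (swap (↥ (i ℚ./ n)) a g) (cong (ℤ._* a) (ℚP.↥-/ i n))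
      where
      swap : ∀ x y z → x ℤ.* y ℤ.* z ≡ x ℤ.* z ℤ.* y
      swap = solve-∀

    denominator : ∀ a → a ℤ.* ↧ (i ℚ./ n) ℤ.* g ≡ a ℤ.* + n
    denominator a = trans (ℤP.*-assoc a (↧ (i ℚ./ n)) g) (cong (a ℤ.*_) (ℚP.↧-/ i n))

  fraction-≤ : ∀ {q} → i ℚ./ n ℚ.≤ q → i ℤ.* ↧ q ℤ.≤ ↥ q ℤ.* + n
  fraction-≤ {q} i/n≤q = subst₂ ℤ._≤_ (numerator (↧ q)) (denominator (↥ q)) (ℤP.*-monoʳ-≤-nonNeg g (ℚP.drop-*≤* i/n≤q))

  ≤-fraction : ∀ {q} → q ℚ.≤ i ℚ./ n → ↥ q ℤ.* + n ℤ.≤ i ℤ.* ↧ q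
  ≤-fraction {q} q≤i/n = subst₂ ℤ._≤_ (denominator (↥ q)) (numerator (↧ q)) (ℤP.*-monoʳ-≤-nonNeg g (ℚP.drop-*≤* q≤i/n))

leMul-between : ∀ {ta tb q} Y S → LeMul Y S ta → LeMul Y S tb → ta ℝ<ℚ q → q ℚ<ℝ tb → Y ℤ.* ↧ q ℤ.≤ ↥ q ℤ.* S
leMul-between {q = q} Y (+ zero) Y≤0 _ _ _ =
  ℤP.≤-trans (ℤP.*-monoʳ-≤-nonNeg (↧ q) Y≤0) (ℤP.≤-reflexive (sym (ℤP.*-zeroʳ (↥ q))))
leMul-between {ta} {q = q} Y +[1+ n ] Y/S≤ta _ ta<q _ =
  Fraction.fraction-≤ Y (suc n) (ℚP.≮⇒≥ (λ q<Y/S → Y/S≤ta (greater-up ta q<Y/S ta<q)))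
leMul-between {tb = tb} {q} Y -[1+ n ] _ tb≤-Y/S _ q<tb =
  subst₂ ℤ._≤_ (trans (ℤP.neg-distribˡ-* (ℤ.- Y) (↧ q)) (cong (ℤ._* ↧ q) (ℤP.neg-involutive Y)))
               (ℤP.neg-distribʳ-* (↥ q) (+ suc n))
               (ℤP.neg-mono-≤ (Fraction.≤-fraction (ℤ.- Y) (suc n) (ℚP.≮⇒≥ (λ -Y/S<q → tb≤-Y/S (less-down tb -Y/S<q q<tb)))))

below-between : ∀ {ta tb q} p → Below ta p → Below tb p → ta ℝ<ℚ q → q ℚ<ℝ tb → BelowSlope q p
below-between (X , Y) = leMul-between Y (Y ℤ.+ X)

-- ray q spans the line Y = q·(X + Y); the cone between the slopes q₁ < q₂ is
-- spanned by antiray q₂ and ray q₁.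
ray antiray : ℚ → Point
ray q     = (↧ q ℤ.- ↥ q , ↥ q)
antiray q = (↥ q ℤ.- ↧ q , ℤ.- ↥ q)

belowSlope⇒cross-ray : ∀ {q} p → BelowSlope q p → + 0 ℤ.≤ cross p (ray q)
belowSlope⇒cross-ray {q} (X , Y) below = subst (+ 0 ℤ.≤_) (ring X Y (↥ q) (↧ q)) (ℤP.i≤j⇒0≤j-i below)
  where
  ring : ∀ X Y n d → n ℤ.* (Y ℤ.+ X) ℤ.- Y ℤ.* d ≡ X ℤ.* n ℤ.- Y ℤ.* (d ℤ.- n)
  ring = solve-∀

belowSlope⇒cross-antiray : ∀ {q} p → BelowSlope q p → + 0 ℤ.≤ cross (antiray q) p
belowSlope⇒cross-antiray {q} (X , Y) below = subst (+ 0 ℤ.≤_) (ring X Y (↥ q) (↧ q)) (ℤP.i≤j⇒0≤j-i below)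
  where
  ring : ∀ X Y n d → n ℤ.* (Y ℤ.+ X) ℤ.- Y ℤ.* d ≡ (n ℤ.- d) ℤ.* Y ℤ.- ℤ.- n ℤ.* X
  ring = solve-∀

0<cross-antiray-ray : ∀ {q₁ q₂} → q₁ ℚ.< q₂ → + 0 ℤ.< cross (antiray q₂) (ray q₁)
0<cross-antiray-ray {q₁} {q₂} q₁<q₂ =
  subst (+ 0 ℤ.<_) (ring (↥ q₁) (↧ q₁) (↥ q₂) (↧ q₂))
        (subst (ℤ._< ↥ q₂ ℤ.* ↧ q₁ ℤ.- ↥ q₁ ℤ.* ↧ q₂) (ℤP.+-inverseʳ (↥ q₁ ℤ.* ↧ q₂))
               (ℤP.+-monoˡ-< (ℤ.- (↥ q₁ ℤ.* ↧ q₂)) (ℚP.drop-*<* q₁<q₂)))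
  where
  ring : ∀ n₁ d₁ n₂ d₂ → n₂ ℤ.* d₁ ℤ.- n₁ ℤ.* d₂ ≡ (n₂ ℤ.- d₂) ℤ.* n₁ ℤ.- ℤ.- n₂ ℤ.* (d₁ ℤ.- n₁)
  ring = solve-∀

cross-mirror : ∀ sx sy r s → cross (mirror sx sy r) (mirror sx sy s) ≡ (sgn sx ℤ.* sgn sy) ℤ.* cross r s
cross-mirror sx sy (a , b) (c , d) = ring (sgn sx) (sgn sy) a b c d
  where
  ring : ∀ α β a b c d → β ℤ.* a ℤ.* (α ℤ.* d) ℤ.- α ℤ.* b ℤ.* (β ℤ.* c) ≡ α ℤ.* β ℤ.* (a ℤ.* d ℤ.- b ℤ.* c)
  ring = solve-∀

sgn*sgn≢0 : ∀ sx sy → sgn sx ℤ.* sgn sy ≢ + 0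
sgn*sgn≢0 plus  plus  ()
sgn*sgn≢0 plus  minus ()
sgn*sgn≢0 minus plus  ()
sgn*sgn≢0 minus minus ()

mirror-independent : ∀ sx sy r s → + 0 ℤ.< cross r s → cross (mirror sx sy r) (mirror sx sy s) ≢ + 0
mirror-independent sx sy r s 0<Δ Δ′≡0 with ℤP.i*j≡0⇒i≡0∨j≡0 (sgn sx ℤ.* sgn sy) (trans (sym (cross-mirror sx sy r s)) Δ′≡0)
... | inj₁ sxsy≡0 = sgn*sgn≢0 sx sy sxsy≡0
... | inj₂ Δ≡0    = ℤP.<⇒≢ 0<Δ (sym Δ≡0)

within-mirror : ∀ {R} sx sy z → Within R z → Within R (mirror sx sy z)
within-mirror sx sy (x , y) (bx , by) = subst (ℕ._≤ _) (sym (∣sgn*∣ sy x)) bx , subst (ℕ._≤ _) (sym (∣sgn*∣ sx y)) by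

mirror-back : ∀ sx sy O v A B r₁ r₂ →
              O +ᵥ (A ·ᵥ mirror sx sy r₁ +ᵥ B ·ᵥ mirror sx sy r₂) +ᵥ mirror sx sy (mirror sx sy (v -ᵥ O) -ᵥ (A ·ᵥ r₁ +ᵥ B ·ᵥ r₂)) ≡ v
mirror-back sx sy (o₁ , o₂) (x , y) A B (a , b) (c , d) =
  cong₂ _,_ (unmirror (sgn sy) o₁ x a c (sgn-squared sy)) (unmirror (sgn sx) o₂ y b d (sgn-squared sx))
  where
  unmirror : ∀ s o x a c → s ℤ.* s ≡ + 1 → o ℤ.+ (A ℤ.* (s ℤ.* a) ℤ.+ B ℤ.* (s ℤ.* c)) ℤ.+ s ℤ.* (s ℤ.* (x ℤ.- o) ℤ.- (A ℤ.* a ℤ.+ B ℤ.* c)) ≡ x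
  unmirror s o x a c s²≡1 = begin
    o ℤ.+ (A ℤ.* (s ℤ.* a) ℤ.+ B ℤ.* (s ℤ.* c)) ℤ.+ s ℤ.* (s ℤ.* (x ℤ.- o) ℤ.- (A ℤ.* a ℤ.+ B ℤ.* c)) ≡⟨ collect s o x a c A B ⟩
    o ℤ.+ s ℤ.* s ℤ.* (x ℤ.- o)                                                                    ≡⟨ cong (λ k → o ℤ.+ k ℤ.* (x ℤ.- o)) s²≡1 ⟩
    o ℤ.+ + 1 ℤ.* (x ℤ.- o)                                                                         ≡⟨ cancel o x ⟩
    x                                                                                                ∎
    where
    open ≡-Reasoning
    collect : ∀ s o x a c A B → o ℤ.+ (A ℤ.* (s ℤ.* a) ℤ.+ B ℤ.* (s ℤ.* c)) ℤ.+ s ℤ.* (s ℤ.* (x ℤ.- o) ℤ.- (A ℤ.* a ℤ.+ B ℤ.* c))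
                                ≡ o ℤ.+ s ℤ.* s ℤ.* (x ℤ.- o)
    collect = solve-∀
    cancel : ∀ o x → o ℤ.+ + 1 ℤ.* (x ℤ.- o) ≡ x
    cancel = solve-∀

module Exploration (O : Point) (sx sy : Sgn) {q₁ q₂ : ℚ} (q₁<q₂ : q₁ ℚ.< q₂) where

  Rad : ℕ
  Rad = size (antiray q₂) ℕ.+ size (ray q₁)

  open Sweep O (mirror sx sy (antiray q₂)) (mirror sx sy (ray q₁))
             (mirror-independent sx sy (antiray q₂) (ray q₁) (0<cross-antiray-ray q₁<q₂)) Rad public

  visits : ∀ v → BelowSlope q₁ (mirror sx sy (v -ᵥ O)) → BelowSlope q₂ (mirror sx sy (v -ᵥ O)) → Visits c₀ v
  visits v below₁ below₂ = near-lattice-point (cone-near-lattice (antiray q₂) (ray q₁) p (0<cross-antiray-ray q₁<q₂)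
                                                (belowSlope⇒cross-ray {q₁} p below₁) (belowSlope⇒cross-antiray {q₂} p below₂))
    where
    p = mirror sx sy (v -ᵥ O)
    near-lattice-point : (∃ λ A → ∃ λ B → Within Rad (p -ᵥ (+ A ·ᵥ antiray q₂ +ᵥ + B ·ᵥ ray q₁))) → Visits c₀ v
    near-lattice-point (A , B , near) =
      subst (Visits c₀) (trans (cong (_+ᵥ z) (latticePoint-definition (+ A) (+ B))) (mirror-back sx sy O v (+ A) (+ B) (antiray q₂) (ray q₁)))
            (covers-lattice A B z (within-mirror sx sy (p -ᵥ (+ A ·ᵥ antiray q₂ +ᵥ + B ·ᵥ ray q₁)) near))
      where z = mirror sx sy (p -ᵥ (+ A ·ᵥ antiray q₂ +ᵥ + B ·ᵥ ray q₁))

Explorer : ℕ → Point → Sgn → Sgn → ℝ → ℝ → Set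
Explorer p O sx sy t₁ t₂ =
  ∃ λ (A : Automaton p) → ∀ v → Below t₁ (mirror sx sy (v -ᵥ O)) → Below t₂ (mirror sx sy (v -ᵥ O)) → ∃ λ k → pos (run A O k) ≡ v

cone-explorer : ∀ O sx sy {ta tb} → ta ℝ<ℝ tb → Explorer 2 O sx sy ta tb
cone-explorer O sx sy {ta} {tb} (q₁ , ta<q₁ , q₁<tb) with less-open tb q₁<tb
... | q₂ , q₁<q₂ , q₂<tb = machine , λ v belowᵃ belowᵇ →
  visits v (below-between _ belowᵃ belowᵇ ta<q₁ q₁<tb) (below-between _ belowᵃ belowᵇ (greater-up ta q₁<q₂ ta<q₁) q₂<tb)
  where open Exploration O sx sy q₁<q₂

wedge-explorer : ∀ O sx sy {t₁ t₂} → t₁ ℝ<ℝ t₂ ⊎ t₂ ℝ<ℝ t₁ → Explorer 2 O sx sy t₁ t₂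
wedge-explorer O sx sy (inj₁ t₁<t₂) = cone-explorer O sx sy t₁<t₂
wedge-explorer O sx sy (inj₂ t₂<t₁) = swap (cone-explorer O sx sy t₂<t₁)
  where
  swap : ∀ {p t₁ t₂} → Explorer p O sx sy t₂ t₁ → Explorer p O sx sy t₁ t₂
  swap (A , explores) = A , λ v below₁ below₂ → explores v below₂ below₁

explorer⇒explores : ∀ w → Explorer 2 (O w) (σx (d₁ w)) (σy (d₁ w)) (t (d₁ w)) (t (d₂ w)) → ∃ λ (A : Automaton 2) → Explores A w
explorer⇒explores w (A , explores) = A , λ v v∈w → uncurry (explores v) (inWedge⇒below w v v∈w)

lemma7 : (w : OppWedge) → Small w → ∃ λ (A : Automaton 2) → Explores A w
lemma7 w small = explorer⇒explores w (wedge-explorer (O w) (σx (d₁ w)) (σy (d₁ w)) (small⇒ordered w small))
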